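{- For every integer $\ell\ge 3$, letting $C_\ell$ denote the cycle on $\ell$ vertices, \[ f_o(C_\ell)=2\left\lfloor \frac{\ell}{3}\right\rfloor. \] In particular, if $\ell\ne 5$, then $f_o(C_\ell)\ge \ell/2$.
   Context: An induced subgraph $H$ of a graph $G$ is called odd if every vertex of $H$ has odd degree in $H$. $f_o(G)$ denotes the maximum number of vertices of an odd induced subgraph of $G$. -}

module Defs where

open import Data.Nat using (ℕ; zero; suc; _+_; _%_; _⊔_; _≡ᵇ_; _<_; _≤_; s≤s; z≤n)
open import Data.Nat.Properties using (≡ᵇ⇒≡; m≤n⇒m<n∨m≡n; suc-injective)
open import Data.Nat.DivMod using (m<n⇒m%n≡m; n%n≡0)
open import Data.Bool using (Bool; true; false; _∧_; _∨_; if_then_else_; T)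
open import Data.Bool.Properties using (∨-comm)
open import Data.Fin using (Fin; zero; suc; toℕ)
open import Data.Fin.Properties using (toℕ<n)
open import Data.Fin.Subset using (Subset; _∈_; ∣_∣)
open import Data.Vec using (Vec; []; _∷_; lookup)
open import Data.List using (List; []; _∷_; map; _++_; foldr)
open import Data.Sum using (inj₁; inj₂)
open import Relation.Binary.PropositionalEquality using (_≡_; _≢_; refl; sym; trans)

record Graph (n : ℕ) : Set where
  field
    adj     : Fin n → Fin n → Bool
    adj-sym : ∀ u v → adj u v ≡ adj v u
    irrefl  : ∀ v → adj v v ≡ false
open Graph public

countTrue : ∀ {n} → (Fin n → Bool) → ℕ
countTrue {zero}  b = 0
countTrue {suc n} b = (if b zero then 1 else 0) + countTrue (λ i → b (suc i))

inducedDegree : ∀ {n} → Graph n → Subset n → Fin n → ℕ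
inducedDegree G S v = countTrue (λ u → lookup S u ∧ adj G v u)

IsOddInduced : ∀ {n} → Graph n → Subset n → Set
IsOddInduced G S = ∀ v → v ∈ S → inducedDegree G S v % 2 ≡ 1

allFinᵇ : ∀ {m} → (Fin m → Bool) → Bool
allFinᵇ {zero}  p = true
allFinᵇ {suc m} p = p zero ∧ allFinᵇ (λ i → p (suc i))

oddInducedᵇ : ∀ {n} → Graph n → Subset n → Bool
oddInducedᵇ G S =
  allFinᵇ (λ v → if lookup S v then (inducedDegree G S v % 2 ≡ᵇ 1) else true)

allSubsets : ∀ n → List (Subset n)
allSubsets zero    = [] ∷ []
allSubsets (suc n) = map (true ∷_) (allSubsets n) ++ map (false ∷_) (allSubsets n)

-- f_o(G): the maximum number of vertices of an odd induced subgraph of G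
-- (the empty induced subgraph is vacuously odd, so the family is nonempty)
f-o : ∀ {n} → Graph n → ℕ
f-o {n} G = foldr (λ S m → (if oddInducedᵇ G S then ∣ S ∣ else 0) ⊔ m) 0 (allSubsets n)

private
  succMod≢ : ∀ ℓ i → i < suc (suc ℓ) → suc i % suc (suc ℓ) ≢ i
  succMod≢ ℓ i (s≤s i≤) eq with m≤n⇒m<n∨m≡n i≤
  ... | inj₁ i<  = x≢sx (trans (sym (m<n⇒m%n≡m (s≤s i<))) eq)
    where
    x≢sx : ∀ {x} → suc x ≢ x
    x≢sx {zero} ()
    x≢sx {suc x} e = x≢sx (suc-injective e)
  succMod≢ ℓ i (s≤s i≤) eq | inj₂ refl with trans (sym (n%n≡0 (suc (suc ℓ)))) eq
  ... | ()

  noteq : ∀ a b → a ≢ b → (a ≡ᵇ b) ≡ false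
  noteq a b ne with a ≡ᵇ b in e
  ... | false = refl
  ... | true  with ne (≡ᵇ⇒≡ a b (subst′ e))
    where
    subst′ : ∀ {x} → x ≡ true → T x
    subst′ refl = _
  ... | ()

cycleAdj : ∀ k → Fin (3 + k) → Fin (3 + k) → Bool
cycleAdj k i j = (toℕ j ≡ᵇ suc (toℕ i) % (3 + k)) ∨ (toℕ i ≡ᵇ suc (toℕ j) % (3 + k))

cycle : ∀ k → Graph (3 + k)
cycle k = record
  { adj     = cycleAdj k
  ; adj-sym = λ u v → ∨-comm (toℕ v ≡ᵇ suc (toℕ u) % (3 + k)) (toℕ u ≡ᵇ suc (toℕ v) % (3 + k))
  ; irrefl  = λ v → irr v
  }
  where
  irr : ∀ v → cycleAdj k v v ≡ false
  irr v rewrite noteq (toℕ v) (suc (toℕ v) % (3 + k))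
                  (λ e → succMod≢ (suc k) (toℕ v) (toℕ<n v) (sym e))
    = refl

-- In an odd induced subgraph of a cycle every chosen vertex has exactly one chosen neighbour
-- (its degree is odd and at most 2). So the chosen set is a disjoint union of E edges
-- {i, i+1}, giving |S| = 2E, and the vertex after such an edge is never chosen, so the
-- windows {i, i+1, i+2} of the chosen edges are pairwise disjoint, giving 3E ≤ ℓ. Hence
-- |S| ≤ 2⌊ℓ/3⌋, and ⌊ℓ/3⌋ blocks 110 followed by 0s attain it. Finally ℓ ≤ 4⌊ℓ/3⌋ fails
-- only for ℓ = 5.
module Submission where

open import Defs
open import Data.Nat using (ℕ; zero; suc; _+_; _*_; _/_; _%_; _≤_; _<_; _⊔_; _≡ᵇ_; z≤n; s≤s; NonZero)
open import Data.Nat.Properties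
  using ( +-comm; +-assoc; +-suc; +-identityʳ; +-cancelˡ-≡; +-cancelʳ-≡; *-comm
        ; ≤-refl; ≤-trans; ≤-antisym; ≤-pred; <⇒≱; m<n⇒m<1+n; m≤m+n; +-mono-≤; +-monoˡ-≤; *-monoʳ-≤
        ; ⊔-lub; m≤m⊔n; m≤n⊔m; ≡ᵇ⇒≡; ≡⇒≡ᵇ; +-0-commutativeMonoid; module ≤-Reasoning )
open import Data.Nat.DivMod
  using ( _mod_; m%n<n; m<n⇒m%n≡m; m%n%n≡m%n; [m+n]%n≡m%n; %-distribˡ-+; m≡m%n+[m/n]*n
        ; m/n*n≤m; m*n/n≡m; /-monoˡ-≤ )
open import Data.Nat.Divisibility using (_∣_; divides; ∣m+n∣m⇒∣n; n∣m*n; ∣⇒≤)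
open import Data.Nat.Tactic.RingSolver using (solve-∀)
open import Algebra.Properties.CommutativeMonoid.Sum +-0-commutativeMonoid
  using (sum; sum-syntax; sum-cong-≗; ∑-distrib-+; sum-init-last; sum-replicate-zero)
open import Data.Bool using (Bool; true; false; T; _∧_; if_then_else_)
open import Data.Bool.Properties using (∧-identityʳ; ∧-zeroʳ; T-≡; T-∧; T-∨)
open import Data.Fin using (Fin; zero; suc; toℕ)
open import Data.Fin.Properties using (_≟_; toℕ<n; toℕ-injective; toℕ-inject₁; toℕ-fromℕ; toℕ-fromℕ<)
open import Data.Fin.Subset using (Subset; ∣_∣; _∈_)
open import Data.Vec using ([]; _∷_; lookup; tabulate)
open import Data.Vec.Properties using ([]=⇒lookup; lookup⇒[]=; lookup∘tabulate)
open import Data.List using ([]; _∷_; foldr; map)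
open import Data.List.Membership.Propositional using () renaming (_∈_ to _∈ˡ_)
open import Data.List.Membership.Propositional.Properties using (∈-map⁺; ∈-++⁺ˡ; ∈-++⁺ʳ)
open import Data.List.Relation.Unary.Any using (here; there)
open import Data.Empty using (⊥-elim)
open import Data.Product using (_×_; _,_)
open import Data.Sum using (_⊎_; inj₁; inj₂; [_,_]; swap)
open import Data.Sum.Function.Propositional using (_⊎-⇔_)
open import Function using (_∘_; _⇔_; mk⇔; Equivalence)
open import Function.Properties.Equivalence using () renaming (trans to ⇔-trans)
open import Relation.Nullary using (yes; no; does; contradiction)
open import Relation.Binary.PropositionalEquality
  using (_≡_; _≢_; refl; sym; trans; cong; cong₂; subst; module ≡-Reasoning)

𝟙 : Bool → ℕ
𝟙 b = if b then 1 else 0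

𝟙≤1 : ∀ b → 𝟙 b ≤ 1
𝟙≤1 false = z≤n
𝟙≤1 true  = s≤s z≤n

𝟙+𝟙-odd⇒≡1 : ∀ a b → (𝟙 a + 𝟙 b) % 2 ≡ 1 → 𝟙 a + 𝟙 b ≡ 1
𝟙+𝟙-odd⇒≡1 false true  _ = refl
𝟙+𝟙-odd⇒≡1 true  false _ = refl
𝟙+𝟙-odd⇒≡1 false false ()
𝟙+𝟙-odd⇒≡1 true  true  ()

∑-last : ∀ n (g : ℕ → ℕ) → ∑[ i < suc n ] g (toℕ i) ≡ ∑[ i < n ] g (toℕ i) + g n
∑-last n g = trans (sum-init-last {n} (λ i → g (toℕ i)))
  (cong₂ _+_ (sum-cong-≗ {n} (λ i → cong g (toℕ-inject₁ i))) (cong g (toℕ-fromℕ n)))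

∑-rotate : ∀ n (g : ℕ → ℕ) → g n ≡ g 0 → ∑[ i < n ] g (suc (toℕ i)) ≡ ∑[ i < n ] g (toℕ i)
∑-rotate n g gn≡g0 = +-cancelʳ-≡ (g 0) _ _ (begin
  ∑[ i < n ] g (suc (toℕ i)) + g 0 ≡⟨ +-comm _ (g 0) ⟩
  ∑[ i < suc n ] g (toℕ i)         ≡⟨ ∑-last n g ⟩
  ∑[ i < n ] g (toℕ i) + g n       ≡⟨ cong (∑[ i < n ] g (toℕ i) +_) gn≡g0 ⟩
  ∑[ i < n ] g (toℕ i) + g 0       ∎)
  where open ≡-Reasoning

∑-mono-≤ : ∀ {n} {f g : Fin n → ℕ} → (∀ i → f i ≤ g i) → sum f ≤ sum g
∑-mono-≤ {zero}  f≤g = z≤n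
∑-mono-≤ {suc n} f≤g = +-mono-≤ (f≤g zero) (∑-mono-≤ (f≤g ∘ suc))

∑-const-1 : ∀ n → ∑[ i < n ] 1 ≡ n
∑-const-1 zero    = refl
∑-const-1 (suc n) = cong suc (∑-const-1 n)

∑-𝟙-point : ∀ {n} (a : Fin n) (f : Fin n → Bool) → ∑[ u < n ] 𝟙 (does (u ≟ a) ∧ f u) ≡ 𝟙 (f a)
∑-𝟙-point {suc n} zero    f = trans (cong (𝟙 (f zero) +_) (sum-replicate-zero n)) (+-identityʳ _)
∑-𝟙-point {suc n} (suc a) f = ∑-𝟙-point a (f ∘ suc)

countTrue≡∑ : ∀ {n} (b : Fin n → Bool) → countTrue b ≡ ∑[ u < n ] 𝟙 (b u)
countTrue≡∑ {zero}  b = refl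
countTrue≡∑ {suc n} b = cong (𝟙 (b zero) +_) (countTrue≡∑ (b ∘ suc))

∣S∣≡∑ : ∀ {n} (S : Subset n) → ∣ S ∣ ≡ ∑[ u < n ] 𝟙 (lookup S u)
∣S∣≡∑ []          = refl
∣S∣≡∑ (true  ∷ S) = cong suc (∣S∣≡∑ S)
∣S∣≡∑ (false ∷ S) = ∣S∣≡∑ S

-- Periodic 0/1 sequences

-- A subset of the cycle is read as an ℓ-periodic sequence on ℕ, so rotating a cyclic sum is ∑-rotate.
Periodic : ℕ → (ℕ → Bool) → Set
Periodic L y = ∀ i → y (i + L) ≡ y i

OneNeighbour : (ℕ → Bool) → Set
OneNeighbour y = ∀ i → T (y (suc i)) → 𝟙 (y i) + 𝟙 (y (2 + i)) ≡ 1

shift : (ℕ → Bool) → ℕ → Bool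
shift y i = y (suc i)

edge : (ℕ → Bool) → ℕ → Bool
edge y i = y i ∧ y (suc i)

count : ℕ → (ℕ → Bool) → ℕ
count L y = ∑[ i < L ] 𝟙 (y (toℕ i))

shift-periodic : ∀ {L y} → Periodic L y → Periodic L (shift y)
shift-periodic periodic i = periodic (suc i)

edge-periodic : ∀ {L y} → Periodic L y → Periodic L (edge y)
edge-periodic periodic i = cong₂ _∧_ (periodic i) (periodic (suc i))

count-shift : ∀ {L y} → Periodic L y → count L (shift y) ≡ count L y
count-shift {L} {y} periodic = ∑-rotate L (𝟙 ∘ y) (cong 𝟙 (periodic 0))

𝟙b≡𝟙[a∧b]+𝟙[b∧c] : ∀ a b c → (T b → 𝟙 a + 𝟙 c ≡ 1) → 𝟙 b ≡ 𝟙 (a ∧ b) + 𝟙 (b ∧ c)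
𝟙b≡𝟙[a∧b]+𝟙[b∧c] false false _ _   = refl
𝟙b≡𝟙[a∧b]+𝟙[b∧c] true  false _ _   = refl
𝟙b≡𝟙[a∧b]+𝟙[b∧c] false true  _ b⇒1 = sym (b⇒1 _)
𝟙b≡𝟙[a∧b]+𝟙[b∧c] true  true  _ b⇒1 = sym (b⇒1 _)

three-consecutive-edges≤1 : ∀ a b c d → (T b → 𝟙 a + 𝟙 c ≡ 1) → (T c → 𝟙 b + 𝟙 d ≡ 1) →
  𝟙 (a ∧ b) + 𝟙 (b ∧ c) + 𝟙 (c ∧ d) ≤ 1
three-consecutive-edges≤1 false false c     d     _   _   = 𝟙≤1 (c ∧ d)
three-consecutive-edges≤1 true  false c     d     _   _   = 𝟙≤1 (c ∧ d)
three-consecutive-edges≤1 false true  false d     _   _   = z≤n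
three-consecutive-edges≤1 true  true  false d     _   _   = s≤s z≤n
three-consecutive-edges≤1 false true  true  false _   _   = s≤s z≤n
three-consecutive-edges≤1 true  true  true  false b⇒1 _   with b⇒1 _
... | ()
three-consecutive-edges≤1 a     true  true  true  _   c⇒1 with c⇒1 _
... | ()

module _ {L : ℕ} {y : ℕ → Bool} (periodic : Periodic L y) (one : OneNeighbour y) where

  count≡edges+edges : count L y ≡ count L (edge y) + count L (edge y)
  count≡edges+edges = begin
    count L y
      ≡⟨ count-shift periodic ⟨
    count L (shift y)
      ≡⟨ sum-cong-≗ {L} (λ i → 𝟙b≡𝟙[a∧b]+𝟙[b∧c] _ _ _ (one (toℕ i))) ⟩
    ∑[ i < L ] (𝟙 (edge y (toℕ i)) + 𝟙 (edge y (suc (toℕ i))))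
      ≡⟨ ∑-distrib-+ {L} _ _ ⟩
    count L (edge y) + count L (shift (edge y))
      ≡⟨ cong (count L (edge y) +_) (count-shift (edge-periodic periodic)) ⟩
    count L (edge y) + count L (edge y) ∎
    where open ≡-Reasoning

  edges*3≤L : count L (edge y) * 3 ≤ L
  edges*3≤L = begin
    E * 3
      ≡⟨ x*3≡x+x+x E ⟩
    E + E + E
      ≡⟨ cong₂ (λ m n → E + m + n) (count-shift e-periodic)
               (trans (count-shift (shift-periodic e-periodic)) (count-shift e-periodic)) ⟨
    E + count L (shift e) + count L (shift (shift e))
      ≡⟨ trans (∑-distrib-+ {L} _ _) (cong (_+ count L (shift (shift e))) (∑-distrib-+ {L} _ _)) ⟨
    ∑[ i < L ] (𝟙 (e (toℕ i)) + 𝟙 (e (1 + toℕ i)) + 𝟙 (e (2 + toℕ i)))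
      ≤⟨ ∑-mono-≤ {L} (λ i → three-consecutive-edges≤1 _ _ _ _ (one (toℕ i)) (one (suc (toℕ i)))) ⟩
    ∑[ i < L ] 1
      ≡⟨ ∑-const-1 L ⟩
    L ∎
    where
    open ≤-Reasoning
    e : ℕ → Bool
    e = edge y
    E : ℕ
    E = count L e
    e-periodic : Periodic L e
    e-periodic = edge-periodic periodic
    x*3≡x+x+x : ∀ x → x * 3 ≡ x + x + x
    x*3≡x+x+x = solve-∀

  count≤2*[L/3] : count L y ≤ 2 * (L / 3)
  count≤2*[L/3] = begin
    count L y       ≡⟨ count≡edges+edges ⟩
    E + E           ≡⟨ cong (E +_) (+-identityʳ E) ⟨
    2 * E           ≤⟨ *-monoʳ-≤ 2 E≤L/3 ⟩
    2 * (L / 3)     ∎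
    where
    open ≤-Reasoning
    E : ℕ
    E = count L (edge y)
    E≤L/3 : E ≤ L / 3
    E≤L/3 = subst (_≤ L / 3) (m*n/n≡m E 3) (/-monoˡ-≤ 3 edges*3≤L)

-- Odd induced subgraphs of an arbitrary graph

inducedDegree-two-neighbours : ∀ {n} (G : Graph n) (S : Subset n) {v a b : Fin n} → a ≢ b →
  (∀ u → T (adj G v u) ⇔ (u ≡ a ⊎ u ≡ b)) →
  inducedDegree G S v ≡ 𝟙 (lookup S a) + 𝟙 (lookup S b)
inducedDegree-two-neighbours {n} G S {v} {a} {b} a≢b neighbours = begin
  inducedDegree G S v
    ≡⟨ countTrue≡∑ (λ u → lookup S u ∧ adj G v u) ⟩
  ∑[ u < n ] 𝟙 (lookup S u ∧ adj G v u)
    ≡⟨ sum-cong-≗ {n} split ⟩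
  ∑[ u < n ] (𝟙 (does (u ≟ a) ∧ lookup S u) + 𝟙 (does (u ≟ b) ∧ lookup S u))
    ≡⟨ ∑-distrib-+ {n} _ _ ⟩
  ∑[ u < n ] 𝟙 (does (u ≟ a) ∧ lookup S u) + ∑[ u < n ] 𝟙 (does (u ≟ b) ∧ lookup S u)
    ≡⟨ cong₂ _+_ (∑-𝟙-point a (lookup S)) (∑-𝟙-point b (lookup S)) ⟩
  𝟙 (lookup S a) + 𝟙 (lookup S b) ∎
  where
  open ≡-Reasoning
  split : ∀ u → 𝟙 (lookup S u ∧ adj G v u) ≡ 𝟙 (does (u ≟ a) ∧ lookup S u) + 𝟙 (does (u ≟ b) ∧ lookup S u)
  split u with u ≟ a | u ≟ b | adj G v u | neighbours u
  ... | yes refl | yes refl | _     | _    = ⊥-elim (a≢b refl)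
  ... | yes refl | no _     | true  | _    = trans (cong 𝟙 (∧-identityʳ _)) (sym (+-identityʳ _))
  ... | no _     | yes refl | true  | _    = cong 𝟙 (∧-identityʳ _)
  ... | yes refl | no _     | false | adj⇔ = ⊥-elim (Equivalence.from adj⇔ (inj₁ refl))
  ... | no _     | yes refl | false | adj⇔ = ⊥-elim (Equivalence.from adj⇔ (inj₂ refl))
  ... | no u≢a   | no u≢b   | true  | adj⇔ = ⊥-elim ([ u≢a , u≢b ] (Equivalence.to adj⇔ _))
  ... | no _     | no _     | false | _    = cong 𝟙 (∧-zeroʳ _)

T-allFinᵇ : ∀ {m} (p : Fin m → Bool) → T (allFinᵇ p) ⇔ (∀ i → T (p i))
T-allFinᵇ {zero}  p = mk⇔ (λ _ ()) _
T-allFinᵇ {suc m} p = mk⇔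
  (λ t → let (p₀ , rest) = Equivalence.to T-∧ t in
    λ { zero → p₀ ; (suc i) → Equivalence.to (T-allFinᵇ (p ∘ suc)) rest i })
  (λ all → Equivalence.from T-∧ (all zero , Equivalence.from (T-allFinᵇ (p ∘ suc)) (all ∘ suc)))

T-oddInducedᵇ : ∀ {n} (G : Graph n) (S : Subset n) → T (oddInducedᵇ G S) ⇔ IsOddInduced G S
T-oddInducedᵇ G S = mk⇔
  (λ t v v∈S → ≡ᵇ⇒≡ _ 1 (if-true (Equivalence.to (T-allFinᵇ _) t v) ([]=⇒lookup v∈S)))
  (λ odd → Equivalence.from (T-allFinᵇ _) (λ v → odd-if-in v (odd v)))
  where
  if-true : ∀ {b x} → T (if b then x else true) → b ≡ true → T x
  if-true t refl = t
  odd-if-in : ∀ v → (v ∈ S → inducedDegree G S v % 2 ≡ 1) →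
    T (if lookup S v then inducedDegree G S v % 2 ≡ᵇ 1 else true)
  odd-if-in v odd with lookup S v in S[v]
  ... | true  = ≡⇒≡ᵇ _ 1 (odd (lookup⇒[]= v S S[v]))
  ... | false = _

module _ {A : Set} (F : A → ℕ) where

  foldr-⊔-lub : ∀ {m} xs → (∀ x → F x ≤ m) → foldr (λ x r → F x ⊔ r) 0 xs ≤ m
  foldr-⊔-lub []       F≤m = z≤n
  foldr-⊔-lub (x ∷ xs) F≤m = ⊔-lub (F≤m x) (foldr-⊔-lub xs F≤m)

  foldr-⊔-upper : ∀ {x} xs → x ∈ˡ xs → F x ≤ foldr (λ x r → F x ⊔ r) 0 xs
  foldr-⊔-upper (x ∷ xs) (here refl)  = m≤m⊔n (F x) _
  foldr-⊔-upper (y ∷ xs) (there x∈xs) = ≤-trans (foldr-⊔-upper xs x∈xs) (m≤n⊔m (F y) _)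

∈-allSubsets : ∀ {n} (S : Subset n) → S ∈ˡ allSubsets n
∈-allSubsets []                  = here refl
∈-allSubsets (true  ∷ S)         = ∈-++⁺ˡ (∈-map⁺ (true ∷_) (∈-allSubsets S))
∈-allSubsets {suc n} (false ∷ S) = ∈-++⁺ʳ (map (true ∷_) (allSubsets n)) (∈-map⁺ (false ∷_) (∈-allSubsets S))

module _ {n} (G : Graph n) where

  private
    oddSize : Subset n → ℕ
    oddSize S = if oddInducedᵇ G S then ∣ S ∣ else 0

  ∣S∣≤f-o : ∀ {S} → IsOddInduced G S → ∣ S ∣ ≤ f-o G
  ∣S∣≤f-o {S} odd = ≤-trans ∣S∣≤oddSize (foldr-⊔-upper oddSize (allSubsets n) (∈-allSubsets S))
    where
    ∣S∣≤oddSize : ∣ S ∣ ≤ oddSize S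
    ∣S∣≤oddSize rewrite Equivalence.to T-≡ (Equivalence.from (T-oddInducedᵇ G S) odd) = ≤-refl

  f-o≤ : ∀ {m} → (∀ S → IsOddInduced G S → ∣ S ∣ ≤ m) → f-o G ≤ m
  f-o≤ {m} bound = foldr-⊔-lub oddSize (allSubsets n) oddSize≤m
    where
    oddSize≤m : ∀ S → oddSize S ≤ m
    oddSize≤m S with oddInducedᵇ G S in isOdd
    ... | true  = bound S (Equivalence.to (T-oddInducedᵇ G S) (Equivalence.from T-≡ isOdd))
    ... | false = z≤n

-- The cycle C_ℓ

[m+n%d]%d≡[m+n]%d : ∀ m n d .{{_ : NonZero d}} → (m + n % d) % d ≡ (m + n) % d
[m+n%d]%d≡[m+n]%d m n d = begin
  (m + n % d) % d           ≡⟨ %-distribˡ-+ m (n % d) d ⟩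
  (m % d + n % d % d) % d   ≡⟨ cong (λ r → (m % d + r) % d) (m%n%n≡m%n n d) ⟩
  (m % d + n % d) % d       ≡⟨ %-distribˡ-+ m n d ⟨
  (m + n) % d               ∎
  where open ≡-Reasoning

[d+m]%n≡m%n⇒n∣d : ∀ d m n .{{_ : NonZero n}} → (d + m) % n ≡ m % n → n ∣ d
[d+m]%n≡m%n⇒n∣d d m n eq =
  ∣m+n∣m⇒∣n (divides ((d + m) / n) (+-cancelˡ-≡ r _ _ shifted)) (n∣m*n (m / n))
  where
  open ≡-Reasoning
  r : ℕ
  r = m % n
  shifted : r + (m / n * n + d) ≡ r + (d + m) / n * n
  shifted = begin
    r + (m / n * n + d)           ≡⟨ +-assoc r _ d ⟨
    r + m / n * n + d             ≡⟨ cong (_+ d) (m≡m%n+[m/n]*n m n) ⟨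
    m + d                         ≡⟨ +-comm m d ⟩
    d + m                         ≡⟨ m≡m%n+[m/n]*n (d + m) n ⟩
    (d + m) % n + (d + m) / n * n ≡⟨ cong (_+ (d + m) / n * n) eq ⟩
    r + (d + m) / n * n           ∎

pairs : ℕ → ℕ → Bool
pairs zero    _                   = false
pairs (suc q) 0                   = true
pairs (suc q) 1                   = true
pairs (suc q) 2                   = false
pairs (suc q) (suc (suc (suc i))) = pairs q i

pairs-bound : ∀ q i → T (pairs q i) → 2 + i ≤ q * 3
pairs-bound (suc q) 0                   _ = s≤s (s≤s z≤n)
pairs-bound (suc q) 1                   _ = s≤s (s≤s (s≤s z≤n))
pairs-bound (suc q) (suc (suc (suc i))) t = s≤s (s≤s (s≤s (pairs-bound q i t)))

pairs-beyond : ∀ q i → q * 3 < 2 + i → pairs q i ≡ false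
pairs-beyond q i q*3<2+i with pairs q i in eq
... | true  = contradiction (pairs-bound q i (Equivalence.from T-≡ eq)) (<⇒≱ q*3<2+i)
... | false = refl

pairs-0⇒1 : ∀ q → T (pairs q 0) → T (pairs q 1)
pairs-0⇒1 (suc q) _ = _

pairs-oneNeighbour : ∀ q → OneNeighbour (pairs q)
pairs-oneNeighbour (suc q)       0                   _ = refl
pairs-oneNeighbour (suc (suc q)) 2                   _ = refl
pairs-oneNeighbour (suc q)       (suc (suc (suc i))) t = pairs-oneNeighbour q i t

count-pairs : ∀ q n → q * 3 ≤ n → count n (pairs q) ≡ q * 2
count-pairs zero    n                   _                        = sum-replicate-zero n
count-pairs (suc q) (suc (suc (suc n))) (s≤s (s≤s (s≤s q*3≤n))) = cong (2 +_) (count-pairs q n q*3≤n)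

module Cycle (k : ℕ) where

  ℓ : ℕ
  ℓ = 3 + k

  vertex : ℕ → Fin ℓ
  vertex m = m mod ℓ

  toℕ-vertex : ∀ m → toℕ (vertex m) ≡ m % ℓ
  toℕ-vertex m = toℕ-fromℕ< (m%n<n m ℓ)

  vertex-cong : ∀ {m n} → m % ℓ ≡ n % ℓ → vertex m ≡ vertex n
  vertex-cong {m} {n} eq = toℕ-injective (trans (toℕ-vertex m) (trans eq (sym (toℕ-vertex n))))

  vertex-toℕ : ∀ v → vertex (toℕ v) ≡ v
  vertex-toℕ v = toℕ-injective (trans (toℕ-vertex (toℕ v)) (m<n⇒m%n≡m (toℕ<n v)))

  vertex-+ℓ : ∀ m → vertex (m + ℓ) ≡ vertex m
  vertex-+ℓ m = vertex-cong {m + ℓ} {m} ([m+n]%n≡m%n m ℓ)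

  vertex-ℓ+ : ∀ m → vertex (ℓ + m) ≡ vertex m
  vertex-ℓ+ m = trans (cong vertex (+-comm ℓ m)) (vertex-+ℓ m)

  vertex-+-toℕ : ∀ n m → vertex (n + toℕ (vertex m)) ≡ vertex (n + m)
  vertex-+-toℕ n m = vertex-cong {n + toℕ (vertex m)} {n + m}
    (trans (cong (λ r → (n + r) % ℓ) (toℕ-vertex m)) ([m+n%d]%d≡[m+n]%d n m ℓ))

  next prev : Fin ℓ → Fin ℓ
  next v = vertex (suc (toℕ v))
  prev v = vertex (suc (suc k) + toℕ v)   -- v + (ℓ ∸ 1), kept free of truncated subtraction

  next-vertex : ∀ m → next (vertex m) ≡ vertex (suc m)
  next-vertex = vertex-+-toℕ 1

  prev-vertex-suc : ∀ m → prev (vertex (suc m)) ≡ vertex m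
  prev-vertex-suc m = trans (vertex-+-toℕ (suc (suc k)) (suc m))
    (trans (cong vertex (+-suc (suc (suc k)) m)) (vertex-ℓ+ m))

  next∘prev : ∀ v → next (prev v) ≡ v
  next∘prev v = trans (next-vertex (suc (suc k) + toℕ v)) (trans (vertex-ℓ+ (toℕ v)) (vertex-toℕ v))

  prev∘next : ∀ v → prev (next v) ≡ v
  prev∘next v = trans (prev-vertex-suc (toℕ v)) (vertex-toℕ v)

  next∘next≢id : ∀ v → next (next v) ≢ v
  next∘next≢id v eq = contradiction (∣⇒≤ ℓ∣2) λ { (s≤s (s≤s ())) }
    where
    a : ℕ
    a = toℕ v
    ℓ∣2 : ℓ ∣ 2
    ℓ∣2 = [d+m]%n≡m%n⇒n∣d 2 a ℓ (begin
      (2 + a) % ℓ            ≡⟨ toℕ-vertex (2 + a) ⟨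
      toℕ (vertex (2 + a))   ≡⟨ cong toℕ (trans (sym (next-vertex (suc a))) eq) ⟩
      a                      ≡⟨ m<n⇒m%n≡m (toℕ<n v) ⟨
      a % ℓ                  ∎)
      where open ≡-Reasoning

  prev≢next : ∀ v → prev v ≢ next v
  prev≢next v eq = next∘next≢id (prev v) (trans (cong next (next∘prev v)) (sym eq))

  T-≡ᵇ-next : ∀ u v → T (toℕ u ≡ᵇ suc (toℕ v) % ℓ) ⇔ u ≡ next v
  T-≡ᵇ-next u v = mk⇔
    (λ t → toℕ-injective (trans (≡ᵇ⇒≡ (toℕ u) _ t) (sym (toℕ-vertex (suc (toℕ v))))))
    (λ { refl → ≡⇒≡ᵇ (toℕ (next v)) _ (toℕ-vertex (suc (toℕ v))) })

  ≡next⇔≡prev : ∀ u v → v ≡ next u ⇔ u ≡ prev v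
  ≡next⇔≡prev u v = mk⇔ (λ { refl → sym (prev∘next u) }) (λ { refl → sym (next∘prev v) })

  cycle-neighbours : ∀ v u → T (adj (cycle k) v u) ⇔ (u ≡ prev v ⊎ u ≡ next v)
  cycle-neighbours v u = ⇔-trans T-∨
    (⇔-trans (T-≡ᵇ-next u v ⊎-⇔ ⇔-trans (T-≡ᵇ-next v u) (≡next⇔≡prev u v)) (mk⇔ swap swap))

  inducedDegree-cycle : ∀ S v → inducedDegree (cycle k) S v ≡ 𝟙 (lookup S (prev v)) + 𝟙 (lookup S (next v))
  inducedDegree-cycle S v = inducedDegree-two-neighbours (cycle k) S {v} (prev≢next v) (cycle-neighbours v)

  unroll : Subset ℓ → ℕ → Bool
  unroll S i = lookup S (vertex i)

  unroll-periodic : ∀ S → Periodic ℓ (unroll S)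
  unroll-periodic S i = cong (lookup S) (vertex-+ℓ i)

  count-unroll : ∀ S → count ℓ (unroll S) ≡ ∣ S ∣
  count-unroll S = trans (sum-cong-≗ {ℓ} (λ v → cong (𝟙 ∘ lookup S) (vertex-toℕ v))) (sym (∣S∣≡∑ S))

  IsOddInduced⇒OneNeighbour : ∀ {S} → IsOddInduced (cycle k) S → OneNeighbour (unroll S)
  IsOddInduced⇒OneNeighbour {S} odd i t = 𝟙+𝟙-odd⇒≡1 (unroll S i) (unroll S (2 + i)) (begin
    (𝟙 (unroll S i) + 𝟙 (unroll S (2 + i))) % 2 ≡⟨ cong (_% 2) degree ⟨
    inducedDegree (cycle k) S v % 2               ≡⟨ odd v (lookup⇒[]= v S (Equivalence.to T-≡ t)) ⟩
    1                                             ∎)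
    where
    open ≡-Reasoning
    v : Fin ℓ
    v = vertex (suc i)
    degree : inducedDegree (cycle k) S v ≡ 𝟙 (unroll S i) + 𝟙 (unroll S (2 + i))
    degree = trans (inducedDegree-cycle S v)
      (cong₂ (λ p n → 𝟙 (lookup S p) + 𝟙 (lookup S n)) (prev-vertex-suc i) (next-vertex (suc i)))

  IsOddInduced⇒∣S∣≤2*[ℓ/3] : ∀ {S} → IsOddInduced (cycle k) S → ∣ S ∣ ≤ 2 * (ℓ / 3)
  IsOddInduced⇒∣S∣≤2*[ℓ/3] {S} odd =
    subst (_≤ 2 * (ℓ / 3)) (count-unroll S) (count≤2*[L/3] (unroll-periodic S) (IsOddInduced⇒OneNeighbour odd))

  prev+next≡1⇒IsOddInduced : ∀ {S} →
    (∀ v → T (lookup S v) → 𝟙 (lookup S (prev v)) + 𝟙 (lookup S (next v)) ≡ 1) → IsOddInduced (cycle k) S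
  prev+next≡1⇒IsOddInduced {S} one v v∈S =
    cong (_% 2) (trans (inducedDegree-cycle S v) (one v (Equivalence.from T-≡ ([]=⇒lookup v∈S))))

  q : ℕ
  q = ℓ / 3

  q*3≤ℓ : q * 3 ≤ ℓ
  q*3≤ℓ = m/n*n≤m ℓ 3

  pairsSubset : Subset ℓ
  pairsSubset = tabulate (pairs q ∘ toℕ)

  pairsSubset-lookup : ∀ v → lookup pairsSubset v ≡ pairs q (toℕ v)
  pairsSubset-lookup = lookup∘tabulate (pairs q ∘ toℕ)

  pairsSubset-vertex : ∀ {m} → m < ℓ → lookup pairsSubset (vertex m) ≡ pairs q m
  pairsSubset-vertex {m} m<ℓ =
    trans (pairsSubset-lookup (vertex m)) (cong (pairs q) (trans (toℕ-vertex m) (m<n⇒m%n≡m m<ℓ)))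

  ∣pairsSubset∣ : ∣ pairsSubset ∣ ≡ 2 * q
  ∣pairsSubset∣ = begin
    ∣ pairsSubset ∣                    ≡⟨ ∣S∣≡∑ pairsSubset ⟩
    ∑[ v < ℓ ] 𝟙 (lookup pairsSubset v) ≡⟨ sum-cong-≗ {ℓ} (cong 𝟙 ∘ pairsSubset-lookup) ⟩
    count ℓ (pairs q)                  ≡⟨ count-pairs q ℓ q*3≤ℓ ⟩
    q * 2                              ≡⟨ *-comm q 2 ⟩
    2 * q                              ∎
    where open ≡-Reasoning

  pairsSubset-odd : IsOddInduced (cycle k) pairsSubset
  pairsSubset-odd = prev+next≡1⇒IsOddInduced one
    where
    S : Subset ℓ
    S = pairsSubset
    one : ∀ v → T (lookup S v) → 𝟙 (lookup S (prev v)) + 𝟙 (lookup S (next v)) ≡ 1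
    one zero t = cong₂ (λ a b → 𝟙 a + 𝟙 b)
      (trans (cong (lookup S ∘ vertex) (+-identityʳ (suc (suc k))))
        (trans (pairsSubset-vertex ≤-refl) (pairs-beyond q (suc (suc k)) (s≤s q*3≤ℓ))))
      (trans (pairsSubset-vertex {1} (s≤s (s≤s z≤n))) (Equivalence.to T-≡ (pairs-0⇒1 q t)))
    one (suc v) t = trans
      (cong₂ (λ a b → 𝟙 a + 𝟙 b)
        (trans (cong (lookup S) (trans (cong prev (sym (vertex-toℕ (suc v)))) (prev-vertex-suc w)))
          (pairsSubset-vertex (m<n⇒m<1+n (toℕ<n v))))
        (pairsSubset-vertex 2+w<ℓ))
      (pairs-oneNeighbour q w t′)
      where
      w : ℕ
      w = toℕ v
      t′ : T (pairs q (suc w))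
      t′ = subst T (pairsSubset-lookup (suc v)) t
      2+w<ℓ : 2 + w < ℓ
      2+w<ℓ = ≤-trans (pairs-bound q (suc w) t′) q*3≤ℓ

  f-o-cycle : f-o (cycle k) ≡ 2 * (ℓ / 3)
  f-o-cycle = ≤-antisym
    (f-o≤ (cycle k) (λ _ → IsOddInduced⇒∣S∣≤2*[ℓ/3]))
    (subst (_≤ f-o (cycle k)) ∣pairsSubset∣ (∣S∣≤f-o (cycle k) pairsSubset-odd))

n≤4[n/3] : ∀ n → 6 ≤ n → n ≤ 2 * (2 * (n / 3))
n≤4[n/3] n 6≤n = begin
  n                   ≡⟨ m≡m%n+[m/n]*n n 3 ⟩
  n % 3 + n / 3 * 3   ≤⟨ +-monoˡ-≤ (n / 3 * 3) (≤-trans (≤-pred (m%n<n n 3)) (/-monoˡ-≤ 3 6≤n)) ⟩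
  n / 3 + n / 3 * 3   ≡⟨ x+x*3≡2*[2*x] (n / 3) ⟩
  2 * (2 * (n / 3))   ∎
  where
  open ≤-Reasoning
  x+x*3≡2*[2*x] : ∀ x → x + x * 3 ≡ 2 * (2 * x)
  x+x*3≡2*[2*x] = solve-∀

3+k≤4[[3+k]/3] : ∀ k → 3 + k ≢ 5 → 3 + k ≤ 2 * (2 * ((3 + k) / 3))
3+k≤4[[3+k]/3] 0                   _   = s≤s (s≤s (s≤s z≤n))
3+k≤4[[3+k]/3] 1                   _   = s≤s (s≤s (s≤s (s≤s z≤n)))
3+k≤4[[3+k]/3] 2                   ℓ≢5 = contradiction refl ℓ≢5
3+k≤4[[3+k]/3] (suc (suc (suc k))) _   = n≤4[n/3] (6 + k) (m≤m+n 6 k)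

lemma2p3 : ∀ (k : ℕ) → let ℓ = 3 + k in
    (f-o (cycle k) ≡ 2 * (ℓ / 3)) × (ℓ ≢ 5 → ℓ ≤ 2 * f-o (cycle k))
lemma2p3 k = f-o≡ , λ ℓ≢5 → subst (λ m → 3 + k ≤ 2 * m) (sym f-o≡) (3+k≤4[[3+k]/3] k ℓ≢5)
  where
  f-o≡ : f-o (cycle k) ≡ 2 * ((3 + k) / 3)
  f-o≡ = Cycle.f-o-cycle k
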